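{- Let $K>0$. For $r=1,2$ and every $\epsilon>0$, $|A_{N,r}(K)|\ll_{\epsilon,K}N^{3/2+\epsilon}$, where \[ A_{N,1}(K)=\Big\{\sigma=\begin{pmatrix}a&eb\\c&ed\end{pmatrix}\in\mathcal S_e\ \Big|\ e=\pm1,\ b\big(b-(2-G)d\big)\le GN,\ a\le KN\Big\}, \] \[ A_{N,2}(K)=\Big\{\sigma=\begin{pmatrix}a&eb\\c&ed\end{pmatrix}\in\mathcal S_e\ \Big|\ e=\pm1,\ cd\le N,\ a\le KN\Big\}. \]
   Context: $G=\frac{\sqrt5+1}{2}$, $g=\frac{\sqrt5-1}{2}$. Let $I$ be the identity, $A=\begin{pmatrix}0&1\\1&1\end{pmatrix}$, $B=\begin{pmatrix}1&1\\1&0\end{pmatrix}$, and $\widetilde\Gamma=\{\sigma\in\mathrm{GL}(2,\mathbb Z)\mid\sigma\equiv I,A\text{ or }B\pmod2\}$. For $e=\pm1$, $\mathcal S_e$ is the set of $\sigma=\begin{pmatrix}a&eb\\c&ed\end{pmatrix}\in\widetilde\Gamma$ with integers $0\le d\le b$, $1\le c\le a$, and $a/b>g$ if $e=+1$, $a/b>G+1$ if $e=-1$. The notation $X\ll_{\epsilon,K}Y$ means $|X|\le CY$ for a constant $C$ depending only on $\epsilon,K$. -}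

module Defs where

open import Data.Nat using (ℕ; zero; suc; _^_) renaming (_≤_ to _≤ℕ_; _*_ to _*ℕ_)
open import Data.Integer as ℤ using (ℤ; +_; -[1+_])
open import Data.Integer.Divisibility using () renaming (_∣_ to _∣ℤ_)
open import Data.Rational as ℚ using (ℚ; 0ℚ; ½)
open import Data.Product using (_×_; _,_; Σ; ∃; ∃-syntax)
open import Data.Sum using (_⊎_)
open import Data.List using (List; length)
open import Data.List.Relation.Unary.All using (All)
open import Data.List.Relation.Unary.Unique.Propositional using (Unique)
open import Relation.Binary.PropositionalEquality using (_≡_)

record ℚ√5 : Set where
  constructor _⊕_√5
  field
    re im : ℚ
open ℚ√5 public

infixl 6 _+ᵠ_ _-ᵠ_
infixl 7 _*ᵠ_
infix 4 _<ᵠ_ _≤ᵠ_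

_+ᵠ_ : ℚ√5 → ℚ√5 → ℚ√5
(p ⊕ q √5) +ᵠ (r ⊕ s √5) = (p ℚ.+ r) ⊕ (q ℚ.+ s) √5

-ᵠ_ : ℚ√5 → ℚ√5
-ᵠ (p ⊕ q √5) = (ℚ.- p) ⊕ (ℚ.- q) √5

_-ᵠ_ : ℚ√5 → ℚ√5 → ℚ√5
x -ᵠ y = x +ᵠ (-ᵠ y)

_*ᵠ_ : ℚ√5 → ℚ√5 → ℚ√5
(p ⊕ q √5) *ᵠ (r ⊕ s √5) =
  (p ℚ.* r ℚ.+ (+ 5 ℚ./ 1) ℚ.* (q ℚ.* s)) ⊕ (p ℚ.* s ℚ.+ q ℚ.* r) √5

ℚ→ᵠ : ℚ → ℚ√5
ℚ→ᵠ p = p ⊕ 0ℚ √5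

ℕ→ᵠ : ℕ → ℚ√5
ℕ→ᵠ n = ℚ→ᵠ (+ n ℚ./ 1)

five : ℚ
five = + 5 ℚ./ 1

-- x = p + q√5 is (strictly) positive as a real number
Positive : ℚ√5 → Set
Positive (p ⊕ q √5) =
     (0ℚ ℚ.≤ p × 0ℚ ℚ.≤ q × (0ℚ ℚ.< p ⊎ 0ℚ ℚ.< q))
  ⊎ (0ℚ ℚ.< p × q ℚ.< 0ℚ × five ℚ.* (q ℚ.* q) ℚ.< p ℚ.* p)
  ⊎ (p ℚ.< 0ℚ × 0ℚ ℚ.< q × p ℚ.* p ℚ.< five ℚ.* (q ℚ.* q))

-- x = p + q√5 is nonnegative as a real number
NonNegative : ℚ√5 → Set
NonNegative (p ⊕ q √5) =
     (0ℚ ℚ.≤ p × 0ℚ ℚ.≤ q)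
  ⊎ (0ℚ ℚ.≤ p × q ℚ.< 0ℚ × five ℚ.* (q ℚ.* q) ℚ.≤ p ℚ.* p)
  ⊎ (p ℚ.< 0ℚ × 0ℚ ℚ.≤ q × p ℚ.* p ℚ.≤ five ℚ.* (q ℚ.* q))

_<ᵠ_ : ℚ√5 → ℚ√5 → Set
x <ᵠ y = Positive (y -ᵠ x)

_≤ᵠ_ : ℚ√5 → ℚ√5 → Set
x ≤ᵠ y = NonNegative (y -ᵠ x)

G : ℚ√5
G = ½ ⊕ ½ √5

g : ℚ√5
g = (ℚ.- ½) ⊕ ½ √5

record Mat2 : Set where
  constructor mat
  field
    m11 m12 m21 m22 : ℤ
open Mat2 public

det : Mat2 → ℤ
det σ = m11 σ ℤ.* m22 σ ℤ.- m12 σ ℤ.* m21 σ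

InGL2ℤ : Mat2 → Set
InGL2ℤ σ = det σ ≡ + 1 ⊎ det σ ≡ ℤ.- (+ 1)

_≡₂_ : ℤ → ℤ → Set
x ≡₂ y = + 2 ∣ℤ (x ℤ.- y)

_≡M₂_ : Mat2 → Mat2 → Set
σ ≡M₂ τ = (m11 σ ≡₂ m11 τ) × (m12 σ ≡₂ m12 τ) × (m21 σ ≡₂ m21 τ) × (m22 σ ≡₂ m22 τ)

I₂ A₂ B₂ : Mat2
I₂ = mat (+ 1) (+ 0) (+ 0) (+ 1)
A₂ = mat (+ 0) (+ 1) (+ 1) (+ 1)
B₂ = mat (+ 1) (+ 1) (+ 1) (+ 0)

InΓ̃ : Mat2 → Set
InΓ̃ σ = InGL2ℤ σ × (σ ≡M₂ I₂ ⊎ σ ≡M₂ A₂ ⊎ σ ≡M₂ B₂)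

data Sign : Set where
  plus minus : Sign

signℤ : Sign → ℤ
signℤ plus  = + 1
signℤ minus = ℤ.- (+ 1)

σ⟨_,_,_,_,_⟩ : Sign → ℕ → ℕ → ℕ → ℕ → Mat2
σ⟨ e , a , b , c , d ⟩ = mat (+ a) (signℤ e ℤ.* + b) (+ c) (signℤ e ℤ.* + d)

-- the condition a/b > g (e = +1), a/b > G+1 (e = -1), written as
-- b·g < a resp. b·(G+1) < a (here b ≥ 1, since σ ∈ GL(2,ℤ) forces b ≠ 0)
RatioCond : Sign → ℕ → ℕ → Set
RatioCond plus  a b = ℕ→ᵠ b *ᵠ g <ᵠ ℕ→ᵠ a
RatioCond minus a b = ℕ→ᵠ b *ᵠ (G +ᵠ ℕ→ᵠ 1) <ᵠ ℕ→ᵠ a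

In𝒮 : Sign → ℕ → ℕ → ℕ → ℕ → Set
In𝒮 e a b c d =
  InΓ̃ σ⟨ e , a , b , c , d ⟩ × d ≤ℕ b × 1 ≤ℕ c × c ≤ℕ a × RatioCond e a b

InA₁ : ℚ → ℕ → Mat2 → Set
InA₁ K N σ = ∃[ e ] ∃[ a ] ∃[ b ] ∃[ c ] ∃[ d ]
  (σ ≡ σ⟨ e , a , b , c , d ⟩ × In𝒮 e a b c d
   × ℕ→ᵠ b *ᵠ (ℕ→ᵠ b -ᵠ (ℕ→ᵠ 2 -ᵠ G) *ᵠ ℕ→ᵠ d) ≤ᵠ G *ᵠ ℕ→ᵠ N
   × (+ a ℚ./ 1) ℚ.≤ K ℚ.* (+ N ℚ./ 1))

InA₂ : ℚ → ℕ → Mat2 → Set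
InA₂ K N σ = ∃[ e ] ∃[ a ] ∃[ b ] ∃[ c ] ∃[ d ]
  (σ ≡ σ⟨ e , a , b , c , d ⟩ × In𝒮 e a b c d
   × c *ℕ d ≤ℕ N
   × (+ a ℚ./ 1) ℚ.≤ K ℚ.* (+ N ℚ./ 1))

-- "|S| ≤ C·N^(3/2 + p/q)" for a set S ⊆ Mat2 given as a predicate:
-- every duplicate-free list of elements of S has length L with
-- L^(2q) ≤ C^(2q) · N^(3q + 2p)   (the equivalent integral form).
CardBound : (Mat2 → Set) → ℕ → ℕ → ℕ → ℕ → Set
CardBound S C N p q = (xs : List Mat2) → Unique xs → All S xs →
  length xs ^ (2 *ℕ q) ≤ℕ (C ^ (2 *ℕ q)) *ℕ (N ^ (3 *ℕ q Data.Nat.+ 2 *ℕ p))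

data Idx : Set where
  r1 r2 : Idx

A[_] : Idx → ℚ → ℕ → Mat2 → Set
A[ r1 ] = InA₁
A[ r2 ] = InA₂

{-# OPTIONS --safe #-}
module Submission where

-- Every σ ∈ A_{N,r}(K) is determined by a key (t, x, y, z) of naturals with t < 8, 1 ≤ x,
-- x² ≪ N, y ≤ 2x and xz ≪ N. Here t records e, the sign of ad − bc and, for r = 2, whether
-- c² ≤ N; (x, y, z) is (b, d, ⌊a/b⌋) for r = 1, and for r = 2 it is (c, d, ⌊a/c⌋) if c² ≤ N
-- and (d + ⌊a/c⌋, d, c) otherwise. The key determines σ: ad − bc = ±1 makes d invertible
-- modulo b (resp. c), which fixes a modulo b (resp. c), and the quotient then fixes a.
-- The size conditions come from 2 < √5 < 3: the ratio condition of 𝒮_e gives b < 2a, hence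
-- d ≤ 2c, and the condition of A_{N,1} gives b² ≤ 3N. As y + z(2x + 1) ≪ N, there are
-- ≪ √N · N keys, so |A_{N,r}(K)| ≪ N^{3/2}.

open import Defs

module Embedding where
  open import Data.Nat as ℕ using (ℕ; suc)
  import Data.Nat.Properties as ℕ
  import Data.Nat.Coprimality as Coprime
  open import Data.Integer as ℤ using (+_; -[1+_]; +≤+; +<+)
  import Data.Integer.Properties as ℤ
  open import Data.Rational using (ℚ; mkℚ; _/_; _+_; _*_; _≤_; _<_; *≤*; *<*; ↥_; nonNegative)
  open import Data.Rational.Properties using (normalize-coprime; ≤-trans; *-monoʳ-≤-nonNeg)
  open import Relation.Binary.PropositionalEquality

  ℕ→ℚ : ℕ → ℚ
  ℕ→ℚ n = + n / 1

  ℕ→ℚ-≡-mkℚ : ∀ n → ℕ→ℚ n ≡ mkℚ (+ n) 0 (Coprime.sym (Coprime.1-coprimeTo n))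
  ℕ→ℚ-≡-mkℚ n = normalize-coprime (Coprime.sym (Coprime.1-coprimeTo n))

  ℕ→ℚ-homo-+ : ∀ m n → ℕ→ℚ (m ℕ.+ n) ≡ ℕ→ℚ m + ℕ→ℚ n
  ℕ→ℚ-homo-+ m n rewrite ℕ→ℚ-≡-mkℚ m | ℕ→ℚ-≡-mkℚ n =
    cong (_/ 1) (sym (cong₂ ℤ._+_ (ℤ.*-identityʳ (+ m)) (ℤ.*-identityʳ (+ n))))

  ℕ→ℚ-homo-* : ∀ m n → ℕ→ℚ (m ℕ.* n) ≡ ℕ→ℚ m * ℕ→ℚ n
  ℕ→ℚ-homo-* m n rewrite ℕ→ℚ-≡-mkℚ m | ℕ→ℚ-≡-mkℚ n = cong (_/ 1) (ℤ.pos-* m n)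

  ℕ→ℚ-mono-≤ : ∀ {m n} → m ℕ.≤ n → ℕ→ℚ m ≤ ℕ→ℚ n
  ℕ→ℚ-mono-≤ {m} {n} m≤n rewrite ℕ→ℚ-≡-mkℚ m | ℕ→ℚ-≡-mkℚ n =
    *≤* (subst₂ ℤ._≤_ (sym (ℤ.*-identityʳ (+ m))) (sym (ℤ.*-identityʳ (+ n))) (+≤+ m≤n))

  ℕ→ℚ-cancel-≤ : ∀ {m n} → ℕ→ℚ m ≤ ℕ→ℚ n → m ℕ.≤ n
  ℕ→ℚ-cancel-≤ {m} {n} le rewrite ℕ→ℚ-≡-mkℚ m | ℕ→ℚ-≡-mkℚ n with le
  ... | *≤* p with subst₂ ℤ._≤_ (ℤ.*-identityʳ (+ m)) (ℤ.*-identityʳ (+ n)) p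
  ...   | +≤+ m≤n = m≤n

  ℕ→ℚ-cancel-< : ∀ {m n} → ℕ→ℚ m < ℕ→ℚ n → m ℕ.< n
  ℕ→ℚ-cancel-< {m} {n} lt rewrite ℕ→ℚ-≡-mkℚ m | ℕ→ℚ-≡-mkℚ n with lt
  ... | *<* p with subst₂ ℤ._<_ (ℤ.*-identityʳ (+ m)) (ℤ.*-identityʳ (+ n)) p
  ...   | +<+ m<n = m<n

  infixl 6 _⊞_
  infixl 7 _⊠_

  -- Syntax for polynomials over ℕ, so that ℕ→ℚ is pushed through + and * in one step.
  data Expr : Set where
    ⌜_⌝     : ℕ → Expr
    _⊞_ _⊠_ : Expr → Expr → Expr

  ⟦_⟧ℕ : Expr → ℕ
  ⟦ ⌜ n ⌝ ⟧ℕ  = n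
  ⟦ e ⊞ e′ ⟧ℕ = ⟦ e ⟧ℕ ℕ.+ ⟦ e′ ⟧ℕ
  ⟦ e ⊠ e′ ⟧ℕ = ⟦ e ⟧ℕ ℕ.* ⟦ e′ ⟧ℕ

  ⟦_⟧ℚ : Expr → ℚ
  ⟦ ⌜ n ⌝ ⟧ℚ  = ℕ→ℚ n
  ⟦ e ⊞ e′ ⟧ℚ = ⟦ e ⟧ℚ + ⟦ e′ ⟧ℚ
  ⟦ e ⊠ e′ ⟧ℚ = ⟦ e ⟧ℚ * ⟦ e′ ⟧ℚ

  ℕ→ℚ-⟦⟧ : ∀ e → ℕ→ℚ ⟦ e ⟧ℕ ≡ ⟦ e ⟧ℚ
  ℕ→ℚ-⟦⟧ ⌜ n ⌝    = refl
  ℕ→ℚ-⟦⟧ (e ⊞ e′) = trans (ℕ→ℚ-homo-+ ⟦ e ⟧ℕ ⟦ e′ ⟧ℕ) (cong₂ _+_ (ℕ→ℚ-⟦⟧ e) (ℕ→ℚ-⟦⟧ e′))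
  ℕ→ℚ-⟦⟧ (e ⊠ e′) = trans (ℕ→ℚ-homo-* ⟦ e ⟧ℕ ⟦ e′ ⟧ℕ) (cong₂ _*_ (ℕ→ℚ-⟦⟧ e) (ℕ→ℚ-⟦⟧ e′))

  ≤-∣↥∣ : ∀ p → p ≤ ℕ→ℚ ℤ.∣ ↥ p ∣
  ≤-∣↥∣ (mkℚ (+ n) d _) rewrite ℕ→ℚ-≡-mkℚ n =
    *≤* (subst₂ ℤ._≤_ (sym (ℤ.*-identityʳ (+ n))) (ℤ.pos-* n (suc d)) (+≤+ (ℕ.m≤m*n n (suc d))))
  ≤-∣↥∣ (mkℚ -[1+ n ] d _) rewrite ℕ→ℚ-≡-mkℚ (suc n) =
    *≤* (ℤ.≤-trans (ℤ.≤-reflexive (ℤ.*-identityʳ -[1+ n ])) ℤ.-≤+)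

  ≤-∣↥∣-* : ∀ {a} K N → ℕ→ℚ a ≤ K * ℕ→ℚ N → a ℕ.≤ ℤ.∣ ↥ K ∣ ℕ.* N
  ≤-∣↥∣-* K N a≤KN = ℕ→ℚ-cancel-≤ (≤-trans a≤KN (subst (K * ℕ→ℚ N ≤_) (sym (ℕ→ℚ-homo-* ℤ.∣ ↥ K ∣ N))
    (*-monoʳ-≤-nonNeg (ℕ→ℚ N) {{nonNegative (ℕ→ℚ-mono-≤ {0} {N} ℕ.z≤n)}} (≤-∣↥∣ K))))

module QuadraticField where
  open Embedding
  open import Data.Nat as ℕ using (ℕ)
  open import Data.Rational
    using (ℚ; 0ℚ; _+_; _*_; _-_; -_; _≤_; _<_; _≤?_; _<?_; nonNegative; nonPositive; positive)
  open import Data.Rational.Properties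
  open import Data.Rational.Solver
  open +-*-Solver using (solve; _:=_; _:*_; _:+_; :-_; _:-_)
  open import Data.Product using (_,_)
  open import Data.Sum as Sum using (_⊎_; inj₁; inj₂)
  open import Relation.Binary.PropositionalEquality
  open import Relation.Nullary using (yes; no; contradiction)
  open import Relation.Nullary.Decidable using (toWitness)

  square-nonNeg : ∀ p → 0ℚ ≤ p * p
  square-nonNeg p with ≤-total 0ℚ p
  ... | inj₁ 0≤p = subst (_≤ p * p) (*-zeroʳ p) (*-monoˡ-≤-nonNeg p {{nonNegative 0≤p}} 0≤p)
  ... | inj₂ p≤0 = subst (_≤ p * p) (*-zeroʳ p) (*-monoˡ-≤-nonPos p {{nonPositive p≤0}} p≤0)

  *-nonNeg : ∀ {p q} → 0ℚ ≤ p → 0ℚ ≤ q → 0ℚ ≤ p * q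
  *-nonNeg {p} {q} 0≤p 0≤q = subst (_≤ p * q) (*-zeroʳ p) (*-monoˡ-≤-nonNeg p {{nonNegative 0≤p}} 0≤q)

  *-pos : ∀ {p q} → 0ℚ < p → 0ℚ < q → 0ℚ < p * q
  *-pos {p} {q} 0<p 0<q = subst (_< p * q) (*-zeroʳ p) (*-monoʳ-<-pos p {{positive 0<p}} 0<q)

  square-cancel-≤ : ∀ {p q} → 0ℚ ≤ q → p * p ≤ q * q → p ≤ q
  square-cancel-≤ {p} {q} 0≤q pp≤qq with p ≤? q
  ... | yes p≤q = p≤q
  ... | no p≰q = contradiction (<-≤-trans qq<pp pp≤qq) (<-irrefl refl)
    where
    q<p : q < p
    q<p = ≰⇒> p≰q
    qq<pp : q * q < p * p
    qq<pp = ≤-<-trans (*-monoˡ-≤-nonNeg q {{nonNegative 0≤q}} (<⇒≤ q<p))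
                      (*-monoˡ-<-pos p {{positive (≤-<-trans 0≤q q<p)}} q<p)

  square-cancel-< : ∀ {p q} → 0ℚ ≤ q → p * p < q * q → p < q
  square-cancel-< {p} {q} 0≤q pp<qq with q ≤? p
  ... | no q≰p = ≰⇒> q≰p
  ... | yes q≤p = contradiction (<-≤-trans pp<qq qq≤pp) (<-irrefl refl)
    where
    qq≤pp : q * q ≤ p * p
    qq≤pp = ≤-trans (*-monoˡ-≤-nonNeg q {{nonNegative 0≤q}} q≤p)
                    (*-monoʳ-≤-nonNeg p {{nonNegative (≤-trans 0≤q q≤p)}} q≤p)

  0≤+-of-neg≤ : ∀ {p r} → - r ≤ p → 0ℚ ≤ p + r
  0≤+-of-neg≤ {p} {r} -r≤p = subst (_≤ p + r) (+-inverseˡ r) (+-monoˡ-≤ r -r≤p)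

  0<+-of-neg< : ∀ {p r} → - r < p → 0ℚ < p + r
  0<+-of-neg< {p} {r} -r<p = subst (_< p + r) (+-inverseˡ r) (+-monoˡ-< r -r<p)

  neg-square : ∀ p → - p * - p ≡ p * p
  neg-square = solve 1 (λ p → (:- p) :* (:- p) := p :* p) refl

  square-* : ∀ p q → (p * q) * (p * q) ≡ (p * p) * (q * q)
  square-* = solve 2 (λ p q → (p :* q) :* (p :* q) := (p :* p) :* (q :* q)) refl

  below-√5 : ∀ {k p q} → k * k ≤ five → 0ℚ ≤ p → five * (q * q) ≤ p * p → 0ℚ ≤ p + k * q
  below-√5 {k} {p} {q} kk≤5 0≤p 5qq≤pp = 0≤+-of-neg≤ (square-cancel-≤ 0≤p (begin
    - (k * q) * - (k * q) ≡⟨ trans (neg-square (k * q)) (square-* k q) ⟩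
    (k * k) * (q * q)     ≤⟨ *-monoʳ-≤-nonNeg (q * q) {{nonNegative (square-nonNeg q)}} kk≤5 ⟩
    five * (q * q)        ≤⟨ 5qq≤pp ⟩
    p * p                 ∎))
    where open ≤-Reasoning

  below-√5-< : ∀ {k p q} → k * k ≤ five → 0ℚ ≤ p → five * (q * q) < p * p → 0ℚ < p + k * q
  below-√5-< {k} {p} {q} kk≤5 0≤p 5qq<pp = 0<+-of-neg< (square-cancel-< 0≤p (begin-strict
    - (k * q) * - (k * q) ≡⟨ trans (neg-square (k * q)) (square-* k q) ⟩
    (k * k) * (q * q)     ≤⟨ *-monoʳ-≤-nonNeg (q * q) {{nonNegative (square-nonNeg q)}} kk≤5 ⟩
    five * (q * q)        <⟨ 5qq<pp ⟩
    p * p                 ∎))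
    where open ≤-Reasoning

  above-√5 : ∀ {k p q} → five ≤ k * k → 0ℚ ≤ k → 0ℚ ≤ q → p * p ≤ five * (q * q) → 0ℚ ≤ p + k * q
  above-√5 {k} {p} {q} 5≤kk 0≤k 0≤q pp≤5qq = subst (0ℚ ≤_) (+-comm (k * q) p)
    (0≤+-of-neg≤ (square-cancel-≤ (*-nonNeg 0≤k 0≤q) (begin
      - p * - p         ≡⟨ neg-square p ⟩
      p * p             ≤⟨ pp≤5qq ⟩
      five * (q * q)    ≤⟨ *-monoʳ-≤-nonNeg (q * q) {{nonNegative (square-nonNeg q)}} 5≤kk ⟩
      (k * k) * (q * q) ≡⟨ square-* k q ⟨
      (k * q) * (k * q) ∎)))
    where open ≤-Reasoning

  above-√5-< : ∀ {k p q} → five ≤ k * k → 0ℚ ≤ k → 0ℚ ≤ q → p * p < five * (q * q) → 0ℚ < p + k * q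
  above-√5-< {k} {p} {q} 5≤kk 0≤k 0≤q pp<5qq = subst (0ℚ <_) (+-comm (k * q) p)
    (0<+-of-neg< (square-cancel-< (*-nonNeg 0≤k 0≤q) (begin-strict
      - p * - p         ≡⟨ neg-square p ⟩
      p * p             <⟨ pp<5qq ⟩
      five * (q * q)    ≤⟨ *-monoʳ-≤-nonNeg (q * q) {{nonNegative (square-nonNeg q)}} 5≤kk ⟩
      (k * k) * (q * q) ≡⟨ square-* k q ⟨
      (k * q) * (k * q) ∎)))
    where open ≤-Reasoning

  0<2 : 0ℚ < ℕ→ℚ 2
  0<2 = toWitness {a? = 0ℚ <? ℕ→ℚ 2} _

  0<3 : 0ℚ < ℕ→ℚ 3
  0<3 = toWitness {a? = 0ℚ <? ℕ→ℚ 3} _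

  2²≤5 : ℕ→ℚ 2 * ℕ→ℚ 2 ≤ five
  2²≤5 = toWitness {a? = ℕ→ℚ 2 * ℕ→ℚ 2 ≤? five} _

  5≤3² : five ≤ ℕ→ℚ 3 * ℕ→ℚ 3
  5≤3² = toWitness {a? = five ≤? ℕ→ℚ 3 * ℕ→ℚ 3} _

  -- 2 < √5 < 3: if p + q√5 ≥ 0 then p + 2q ≥ 0 when q ≤ 0 and p + 3q ≥ 0 when q ≥ 0.
  nonNegative⇒ : ∀ x → NonNegative x → 0ℚ ≤ re x + ℕ→ℚ 2 * im x ⊎ 0ℚ ≤ re x + ℕ→ℚ 3 * im x
  nonNegative⇒ x (inj₁ (0≤p , 0≤q)) =
    inj₂ (subst (_≤ re x + ℕ→ℚ 3 * im x) (+-identityʳ 0ℚ) (+-mono-≤ 0≤p (*-nonNeg (<⇒≤ 0<3) 0≤q)))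
  nonNegative⇒ x (inj₂ (inj₁ (0≤p , _ , 5qq≤pp))) =
    inj₁ (below-√5 {ℕ→ℚ 2} {re x} {im x} 2²≤5 0≤p 5qq≤pp)
  nonNegative⇒ x (inj₂ (inj₂ (_ , 0≤q , pp≤5qq))) =
    inj₂ (above-√5 {ℕ→ℚ 3} {re x} {im x} 5≤3² (<⇒≤ 0<3) 0≤q pp≤5qq)

  positive⇒ : ∀ x → Positive x → 0ℚ < re x + ℕ→ℚ 2 * im x ⊎ 0ℚ < re x + ℕ→ℚ 3 * im x
  positive⇒ x (inj₁ (0≤p , 0≤q , inj₁ 0<p)) =
    inj₂ (subst (_< re x + ℕ→ℚ 3 * im x) (+-identityʳ 0ℚ) (+-mono-<-≤ 0<p (*-nonNeg (<⇒≤ 0<3) 0≤q)))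
  positive⇒ x (inj₁ (0≤p , 0≤q , inj₂ 0<q)) =
    inj₂ (subst (_< re x + ℕ→ℚ 3 * im x) (+-identityʳ 0ℚ) (+-mono-≤-< 0≤p (*-pos 0<3 0<q)))
  positive⇒ x (inj₂ (inj₁ (0<p , _ , 5qq<pp))) =
    inj₁ (below-√5-< {ℕ→ℚ 2} {re x} {im x} 2²≤5 (<⇒≤ 0<p) 5qq<pp)
  positive⇒ x (inj₂ (inj₂ (_ , 0<q , pp<5qq))) =
    inj₂ (above-√5-< {ℕ→ℚ 3} {re x} {im x} 5≤3² (<⇒≤ 0<3) (<⇒≤ 0<q) pp<5qq)

  record Doubled (x : ℚ√5) (P Q R S : ℕ) : Set where
    constructor doubled
    field
      re-doubled : ℕ→ℚ 2 * re x ≡ ℕ→ℚ P - ℕ→ℚ Q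
      im-doubled : ℕ→ℚ 2 * im x ≡ ℕ→ℚ R - ℕ→ℚ S

  doubled-combination : ∀ {x} P Q R S k → Doubled x P Q R S →
    ℕ→ℚ 2 * (re x + ℕ→ℚ k * im x) ≡ ℕ→ℚ (P ℕ.+ k ℕ.* R) - ℕ→ℚ (Q ℕ.+ k ℕ.* S)
  doubled-combination {x} P Q R S k (doubled 2p≡ 2q≡) = begin
    ℕ→ℚ 2 * (re x + ℕ→ℚ k * im x)
      ≡⟨ solve 4 (λ t k p q → t :* (p :+ k :* q) := t :* p :+ k :* (t :* q))
               refl (ℕ→ℚ 2) (ℕ→ℚ k) (re x) (im x) ⟩
    ℕ→ℚ 2 * re x + ℕ→ℚ k * (ℕ→ℚ 2 * im x)
      ≡⟨ cong₂ (λ u v → u + ℕ→ℚ k * v) 2p≡ 2q≡ ⟩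
    (ℕ→ℚ P - ℕ→ℚ Q) + ℕ→ℚ k * (ℕ→ℚ R - ℕ→ℚ S)
      ≡⟨ solve 5 (λ P Q R S k → (P :- Q) :+ k :* (R :- S) := (P :+ k :* R) :- (Q :+ k :* S))
               refl (ℕ→ℚ P) (ℕ→ℚ Q) (ℕ→ℚ R) (ℕ→ℚ S) (ℕ→ℚ k) ⟩
    (ℕ→ℚ P + ℕ→ℚ k * ℕ→ℚ R) - (ℕ→ℚ Q + ℕ→ℚ k * ℕ→ℚ S)
      ≡⟨ cong₂ _-_ (ℕ→ℚ-⟦⟧ (⌜ P ⌝ ⊞ ⌜ k ⌝ ⊠ ⌜ R ⌝)) (ℕ→ℚ-⟦⟧ (⌜ Q ⌝ ⊞ ⌜ k ⌝ ⊠ ⌜ S ⌝)) ⟨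
    ℕ→ℚ (P ℕ.+ k ℕ.* R) - ℕ→ℚ (Q ℕ.+ k ℕ.* S) ∎
    where open ≡-Reasoning

  add-half-difference : ∀ {t} m n → ℕ→ℚ 2 * t ≡ ℕ→ℚ m - ℕ→ℚ n → ℕ→ℚ n + ℕ→ℚ 2 * t ≡ ℕ→ℚ m
  add-half-difference m n 2t≡ =
    trans (cong (ℕ→ℚ n +_) 2t≡) (solve 2 (λ m n → n :+ (m :- n) := m) refl (ℕ→ℚ m) (ℕ→ℚ n))

  ≤-of-half-difference : ∀ {t} m n → ℕ→ℚ 2 * t ≡ ℕ→ℚ m - ℕ→ℚ n → 0ℚ ≤ t → n ℕ.≤ m
  ≤-of-half-difference {t} m n 2t≡ 0≤t = ℕ→ℚ-cancel-≤
    (subst₂ _≤_ (+-identityʳ (ℕ→ℚ n)) (add-half-difference {t} m n 2t≡)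
                (+-monoʳ-≤ (ℕ→ℚ n) (*-nonNeg (<⇒≤ 0<2) 0≤t)))

  <-of-half-difference : ∀ {t} m n → ℕ→ℚ 2 * t ≡ ℕ→ℚ m - ℕ→ℚ n → 0ℚ < t → n ℕ.< m
  <-of-half-difference {t} m n 2t≡ 0<t = ℕ→ℚ-cancel-<
    (subst₂ _<_ (+-identityʳ (ℕ→ℚ n)) (add-half-difference {t} m n 2t≡)
                (+-monoʳ-< (ℕ→ℚ n) (*-pos 0<2 0<t)))

  nonNegative-doubled : ∀ {x P Q R S} → Doubled x P Q R S → NonNegative x →
    Q ℕ.+ 2 ℕ.* S ℕ.≤ P ℕ.+ 2 ℕ.* R ⊎ Q ℕ.+ 3 ℕ.* S ℕ.≤ P ℕ.+ 3 ℕ.* R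
  nonNegative-doubled {x} {P} {Q} {R} {S} 2x≡ x≥0 =
    Sum.map (≤-of-half-difference _ _ (doubled-combination {x} P Q R S 2 2x≡))
            (≤-of-half-difference _ _ (doubled-combination {x} P Q R S 3 2x≡))
            (nonNegative⇒ x x≥0)

  positive-doubled : ∀ {x P Q R S} → Doubled x P Q R S → Positive x →
    Q ℕ.+ 2 ℕ.* S ℕ.< P ℕ.+ 2 ℕ.* R ⊎ Q ℕ.+ 3 ℕ.* S ℕ.< P ℕ.+ 3 ℕ.* R
  positive-doubled {x} {P} {Q} {R} {S} 2x≡ x>0 =
    Sum.map (<-of-half-difference _ _ (doubled-combination {x} P Q R S 2 2x≡))
            (<-of-half-difference _ _ (doubled-combination {x} P Q R S 3 2x≡))
            (positive⇒ x x>0)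

module Slack where
  open Embedding
  open QuadraticField using (Doubled; doubled)
  open import Data.Nat using (ℕ; _+_; _*_)
  open import Data.Rational as ℚ using (ℚ; 0ℚ; ½)
  open import Data.Rational.Solver
  open +-*-Solver using (solve; _:=_; con; _:+_; _:*_; :-_; _:-_; Polynomial)
  open import Relation.Binary.PropositionalEquality

  -- ℚ√5 arithmetic on the solver's syntax: re/im of these terms reduce to the same
  -- rationals as re/im of the corresponding ℚ√5 terms, so the solver can compute them.
  record Poly√5 (n : ℕ) : Set where
    constructor _⊕ₚ_
    field reₚ imₚ : Polynomial n
  open Poly√5

  infixl 6 _+ₚ_ _-ₚ_
  infixl 7 _*ₚ_

  _+ₚ_ _-ₚ_ _*ₚ_ : ∀ {n} → Poly√5 n → Poly√5 n → Poly√5 n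
  (p ⊕ₚ q) +ₚ (r ⊕ₚ s) = (p :+ r) ⊕ₚ (q :+ s)
  x -ₚ (r ⊕ₚ s) = x +ₚ ((:- r) ⊕ₚ (:- s))
  (p ⊕ₚ q) *ₚ (r ⊕ₚ s) = (p :* r :+ con five :* (q :* s)) ⊕ₚ (p :* s :+ q :* r)

  ratₚ : ∀ {n} → Polynomial n → Poly√5 n
  ratₚ p = p ⊕ₚ con 0ℚ

  Gₚ gₚ : ∀ {n} → Poly√5 n
  Gₚ = con ½ ⊕ₚ con ½
  gₚ = con (ℚ.- ½) ⊕ₚ con ½

  doubled-⟦⟧ : ∀ {x} P Q R S → ℕ→ℚ 2 ℚ.* re x ≡ ⟦ P ⟧ℚ ℚ.- ⟦ Q ⟧ℚ → ℕ→ℚ 2 ℚ.* im x ≡ ⟦ R ⟧ℚ ℚ.- ⟦ S ⟧ℚ →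
    Doubled x ⟦ P ⟧ℕ ⟦ Q ⟧ℕ ⟦ R ⟧ℕ ⟦ S ⟧ℕ
  doubled-⟦⟧ P Q R S 2re≡ 2im≡ = doubled
    (trans 2re≡ (sym (cong₂ ℚ._-_ (ℕ→ℚ-⟦⟧ P) (ℕ→ℚ-⟦⟧ Q))))
    (trans 2im≡ (sym (cong₂ ℚ._-_ (ℕ→ℚ-⟦⟧ R) (ℕ→ℚ-⟦⟧ S))))

  A₁-slack : ℕ → ℕ → ℕ → ℚ√5
  A₁-slack N b d = G *ᵠ ℕ→ᵠ N -ᵠ ℕ→ᵠ b *ᵠ (ℕ→ᵠ b -ᵠ (ℕ→ᵠ 2 -ᵠ G) *ᵠ ℕ→ᵠ d)

  A₁-slack-doubled : ∀ N b d → Doubled (A₁-slack N b d) (N + 3 * (b * d)) (2 * (b * b)) N (b * d)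
  A₁-slack-doubled N b d =
    doubled-⟦⟧ (⌜ N ⌝ ⊞ ⌜ 3 ⌝ ⊠ (⌜ b ⌝ ⊠ ⌜ d ⌝)) (⌜ 2 ⌝ ⊠ (⌜ b ⌝ ⊠ ⌜ b ⌝)) ⌜ N ⌝ (⌜ b ⌝ ⊠ ⌜ d ⌝)
      (solve 3 (λ N b d → con (ℕ→ℚ 2) :* reₚ (slackₚ N b d)
                          := (N :+ con (ℕ→ℚ 3) :* (b :* d)) :- con (ℕ→ℚ 2) :* (b :* b))
             refl (ℕ→ℚ N) (ℕ→ℚ b) (ℕ→ℚ d))
      (solve 3 (λ N b d → con (ℕ→ℚ 2) :* imₚ (slackₚ N b d) := N :- b :* d) refl (ℕ→ℚ N) (ℕ→ℚ b) (ℕ→ℚ d))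
    where
    slackₚ : ∀ {n} → Polynomial n → Polynomial n → Polynomial n → Poly√5 n
    slackₚ N b d = Gₚ *ₚ ratₚ N -ₚ ratₚ b *ₚ (ratₚ b -ₚ (ratₚ (con (ℕ→ℚ 2)) -ₚ Gₚ) *ₚ ratₚ d)

  plus-slack : ℕ → ℕ → ℚ√5
  plus-slack a b = ℕ→ᵠ a -ᵠ ℕ→ᵠ b *ᵠ g

  plus-slack-doubled : ∀ a b → Doubled (plus-slack a b) (2 * a + b) 0 0 b
  plus-slack-doubled a b =
    doubled-⟦⟧ (⌜ 2 ⌝ ⊠ ⌜ a ⌝ ⊞ ⌜ b ⌝) ⌜ 0 ⌝ ⌜ 0 ⌝ ⌜ b ⌝
      (solve 2 (λ a b → con (ℕ→ℚ 2) :* reₚ (slackₚ a b) := (con (ℕ→ℚ 2) :* a :+ b) :- con (ℕ→ℚ 0))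
             refl (ℕ→ℚ a) (ℕ→ℚ b))
      (solve 2 (λ a b → con (ℕ→ℚ 2) :* imₚ (slackₚ a b) := con (ℕ→ℚ 0) :- b) refl (ℕ→ℚ a) (ℕ→ℚ b))
    where
    slackₚ : ∀ {n} → Polynomial n → Polynomial n → Poly√5 n
    slackₚ a b = ratₚ a -ₚ ratₚ b *ₚ gₚ

  minus-slack : ℕ → ℕ → ℚ√5
  minus-slack a b = ℕ→ᵠ a -ᵠ ℕ→ᵠ b *ᵠ (G +ᵠ ℕ→ᵠ 1)

  minus-slack-doubled : ∀ a b → Doubled (minus-slack a b) (2 * a) (3 * b) 0 b
  minus-slack-doubled a b =
    doubled-⟦⟧ (⌜ 2 ⌝ ⊠ ⌜ a ⌝) (⌜ 3 ⌝ ⊠ ⌜ b ⌝) ⌜ 0 ⌝ ⌜ b ⌝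
      (solve 2 (λ a b → con (ℕ→ℚ 2) :* reₚ (slackₚ a b) := con (ℕ→ℚ 2) :* a :- con (ℕ→ℚ 3) :* b)
             refl (ℕ→ℚ a) (ℕ→ℚ b))
      (solve 2 (λ a b → con (ℕ→ℚ 2) :* imₚ (slackₚ a b) := con (ℕ→ℚ 0) :- b) refl (ℕ→ℚ a) (ℕ→ℚ b))
    where
    slackₚ : ∀ {n} → Polynomial n → Polynomial n → Poly√5 n
    slackₚ a b = ratₚ a -ₚ ratₚ b *ₚ (Gₚ +ₚ ratₚ (con (ℕ→ℚ 1)))

module EntryBounds where
  open QuadraticField using (nonNegative-doubled; positive-doubled)
  open Slack
  open import Data.Nat
  open import Data.Nat.Properties
  open import Data.Nat.Tactic.RingSolver using (solve-∀)
  open import Data.Sum using (_⊎_; inj₁; inj₂)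
  open import Relation.Binary.PropositionalEquality

  b<2a-of-plus-slack : ∀ a b → 2 * b < 2 * a + b + 0 ⊎ 3 * b < 2 * a + b + 0 → b < 2 * a
  b<2a-of-plus-slack a b (inj₁ 2b<2a+b) =
    +-cancelʳ-< b b (2 * a) (subst₂ _<_ (cong (b +_) (+-identityʳ b)) (+-identityʳ (2 * a + b)) 2b<2a+b)
  b<2a-of-plus-slack a b (inj₂ 3b<2a+b) = <-≤-trans (*-cancelˡ-< 2 b a 2b<2a) (m≤n*m a 2)
    where
    2b<2a : 2 * b < 2 * a
    2b<2a = +-cancelʳ-< b (2 * b) (2 * a) (subst₂ _<_ (+-comm b (2 * b)) (+-identityʳ (2 * a + b)) 3b<2a+b)

  b<2a-of-minus-slack : ∀ a b → 3 * b + 2 * b < 2 * a + 0 ⊎ 3 * b + 3 * b < 2 * a + 0 → b < 2 * a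
  b<2a-of-minus-slack a b h = ≤-<-trans (≤-trans (m≤n*m b 3) (m≤m+n (3 * b) (2 * b)))
                                        (subst (3 * b + 2 * b <_) (+-identityʳ (2 * a)) (5b<2a h))
    where
    5b<2a : 3 * b + 2 * b < 2 * a + 0 ⊎ 3 * b + 3 * b < 2 * a + 0 → 3 * b + 2 * b < 2 * a + 0
    5b<2a (inj₁ 5b<2a) = 5b<2a
    5b<2a (inj₂ 6b<2a) = ≤-<-trans (+-monoʳ-≤ (3 * b) (*-monoˡ-≤ b (n≤1+n 2))) 6b<2a

  ratio⇒b<2a : ∀ e a b → RatioCond e a b → b < 2 * a
  ratio⇒b<2a plus  a b cond = b<2a-of-plus-slack a b (positive-doubled (plus-slack-doubled a b) cond)
  ratio⇒b<2a minus a b cond = b<2a-of-minus-slack a b (positive-doubled (minus-slack-doubled a b) cond)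

  ≤3*-of-A₁-slack : ∀ N x y → y ≤ x →
    2 * x + 2 * y ≤ N + 3 * y + 2 * N ⊎ 2 * x + 3 * y ≤ N + 3 * y + 3 * N → x ≤ 3 * N
  ≤3*-of-A₁-slack N x y y≤x (inj₁ h) = +-cancelʳ-≤ x x (3 * N) (begin
    x + x     ≤⟨ +-cancelʳ-≤ (2 * y) (x + x) (3 * N + y) (subst₂ _≤_ (regroupˡ x y) (regroupʳ N y) h) ⟩
    3 * N + y ≤⟨ +-monoʳ-≤ (3 * N) y≤x ⟩
    3 * N + x ∎)
    where
    open ≤-Reasoning
    regroupˡ : ∀ x y → 2 * x + 2 * y ≡ x + x + 2 * y
    regroupˡ = solve-∀
    regroupʳ : ∀ N y → N + 3 * y + 2 * N ≡ 3 * N + y + 2 * y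
    regroupʳ = solve-∀
  ≤3*-of-A₁-slack N x y _ (inj₂ h) = ≤-trans (*-cancelˡ-≤ 2 2x≤2[2N]) (*-monoˡ-≤ N (n≤1+n 2))
    where
    regroup : ∀ N y → N + 3 * y + 3 * N ≡ 2 * (2 * N) + 3 * y
    regroup = solve-∀
    2x≤2[2N] : 2 * x ≤ 2 * (2 * N)
    2x≤2[2N] = +-cancelʳ-≤ (3 * y) (2 * x) (2 * (2 * N)) (subst (2 * x + 3 * y ≤_) (regroup N y) h)

  b²≤3N : ∀ N b d → d ≤ b → ℕ→ᵠ b *ᵠ (ℕ→ᵠ b -ᵠ (ℕ→ᵠ 2 -ᵠ G) *ᵠ ℕ→ᵠ d) ≤ᵠ G *ᵠ ℕ→ᵠ N → b * b ≤ 3 * N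
  b²≤3N N b d d≤b cond =
    ≤3*-of-A₁-slack N (b * b) (b * d) (*-monoʳ-≤ b d≤b) (nonNegative-doubled (A₁-slack-doubled N b d) cond)

module Unimodular where
  open import Data.Nat
  open import Data.Nat.Properties
  open import Data.Nat.DivMod using (_/_; _%_; m≡m%n+[m/n]*n; m%n<n)
  open import Data.Nat.Divisibility using (_∣_; ∣-refl; ∣m+n∣m⇒∣n; ∣1⇒≡1; ∣m⇒∣m*n; ∣n⇒∣m*n; >⇒∤)
  open import Data.Nat.Coprimality using (Coprime; coprime-divisor)
  open import Data.Nat.Tactic.RingSolver using (solve; solve-∀)
  open import Data.Integer as ℤ using (+_)
  import Data.Integer.Properties as ℤ
  open import Data.Integer.Solver using (module +-*-Solver)
  open +-*-Solver using (_:=_; _:+_; _:*_; _:-_) renaming (solve to ℤ-solve)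
  open import Data.List using (_∷_; [])
  open import Data.Product using (_×_; _,_; ∃-syntax)
  open import Data.Sum using (inj₁; inj₂)
  open import Relation.Binary.PropositionalEquality
  open import Relation.Nullary using (contradiction)

  Unimodular : Sign → ℕ → ℕ → ℕ → ℕ → Set
  Unimodular plus  a b c d = a * d ≡ b * c + 1
  Unimodular minus a b c d = b * c ≡ a * d + 1

  opposite : Sign → Sign
  opposite plus  = minus
  opposite minus = plus

  signℤ-opposite : ∀ e → signℤ e ℤ.* ℤ.- + 1 ≡ signℤ (opposite e)
  signℤ-opposite plus  = refl
  signℤ-opposite minus = refl

  signℤ-involutive : ∀ e z → signℤ e ℤ.* (signℤ e ℤ.* z) ≡ z
  signℤ-involutive plus  z = trans (ℤ.*-identityˡ _) (ℤ.*-identityˡ z)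
  signℤ-involutive minus z = trans (ℤ.-1*i≡-i _) (trans (cong ℤ.-_ (ℤ.-1*i≡-i z)) (ℤ.neg-involutive z))

  det-σ : ∀ e a b c d → det σ⟨ e , a , b , c , d ⟩ ≡ signℤ e ℤ.* (+ (a * d) ℤ.- + (b * c))
  det-σ e a b c d rewrite ℤ.pos-* a d | ℤ.pos-* b c =
    ℤ-solve 5 (λ s a b c d → a :* (s :* d) :- (s :* b) :* c := s :* (a :* d :- b :* c))
            refl (signℤ e) (+ a) (+ b) (+ c) (+ d)

  ad-bc≡signℤ*det : ∀ e a b c d → + (a * d) ℤ.- + (b * c) ≡ signℤ e ℤ.* det σ⟨ e , a , b , c , d ⟩
  ad-bc≡signℤ*det e a b c d = trans (sym (signℤ-involutive e _)) (cong (signℤ e ℤ.*_) (sym (det-σ e a b c d)))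

  unimodular-from-ℤ : ∀ t a b c d → + (a * d) ℤ.- + (b * c) ≡ signℤ t → Unimodular t a b c d
  unimodular-from-ℤ plus a b c d eq = ℤ.+-injective (begin
    + (a * d)                             ≡⟨ ℤ-solve 2 (λ x y → x := x :- y :+ y) refl (+ (a * d)) (+ (b * c)) ⟩
    + (a * d) ℤ.- + (b * c) ℤ.+ + (b * c) ≡⟨ cong (ℤ._+ + (b * c)) eq ⟩
    + (1 + b * c)                         ≡⟨ cong +_ (+-comm 1 (b * c)) ⟩
    + (b * c + 1)                         ∎)
    where open ≡-Reasoning
  unimodular-from-ℤ minus a b c d eq = ℤ.+-injective (begin
    + (b * c)                               ≡⟨ ℤ-solve 2 (λ x y → y := x :- (x :- y)) refl (+ (a * d)) (+ (b * c)) ⟩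
    + (a * d) ℤ.- (+ (a * d) ℤ.- + (b * c)) ≡⟨ cong (λ z → + (a * d) ℤ.- z) eq ⟩
    + (a * d) ℤ.+ + 1                       ∎)
    where open ≡-Reasoning

  unimodular : ∀ e a b c d → InGL2ℤ σ⟨ e , a , b , c , d ⟩ → ∃[ t ] Unimodular t a b c d
  unimodular e a b c d (inj₁ det≡1) = e , unimodular-from-ℤ e a b c d
    (trans (ad-bc≡signℤ*det e a b c d) (trans (cong (signℤ e ℤ.*_) det≡1) (ℤ.*-identityʳ (signℤ e))))
  unimodular e a b c d (inj₂ det≡-1) = opposite e , unimodular-from-ℤ (opposite e) a b c d
    (trans (ad-bc≡signℤ*det e a b c d) (trans (cong (signℤ e ℤ.*_) det≡-1) (signℤ-opposite e)))

  unimodular-transpose : ∀ t {a b c d} → Unimodular t a b c d → Unimodular t a c b d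
  unimodular-transpose plus  {b = b} {c} ad≡bc+1 = trans ad≡bc+1 (cong (_+ 1) (*-comm b c))
  unimodular-transpose minus {b = b} {c} bc≡ad+1 = trans (*-comm c b) bc≡ad+1

  unimodular-nonZero : ∀ t {a b c d} → Unimodular t a b c d → d ≤ b → NonZero b
  unimodular-nonZero _     {b = suc _} _ _ = _
  unimodular-nonZero plus  {a} {zero} {c} {zero} a*0≡1 z≤n =
    contradiction (trans (sym (*-zeroʳ a)) a*0≡1) λ ()
  unimodular-nonZero minus {a} {zero} {c} {zero} 0≡a*0+1 z≤n =
    contradiction (trans 0≡a*0+1 (cong (_+ 1) (*-zeroʳ a))) λ ()

  unimodular⇒coprime : ∀ t {a b c d} → Unimodular t a b c d → Coprime b d
  unimodular⇒coprime plus {a} {b} {c} {d} ad≡bc+1 {i} (i∣b , i∣d) =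
    ∣1⇒≡1 (∣m+n∣m⇒∣n (subst (i ∣_) ad≡bc+1 (∣n⇒∣m*n a i∣d)) (∣m⇒∣m*n c i∣b))
  unimodular⇒coprime minus {a} {b} {c} {d} bc≡ad+1 {i} (i∣b , i∣d) =
    ∣1⇒≡1 (∣m+n∣m⇒∣n (subst (i ∣_) bc≡ad+1 (∣m⇒∣m*n c i∣b)) (∣n⇒∣m*n a i∣d))

  unimodular-cross : ∀ t {a b c d a′ c′} → Unimodular t a b c d → Unimodular t a′ b c′ d →
    a * d + b * c′ ≡ a′ * d + b * c
  unimodular-cross plus {a} {b} {c} {d} {a′} {c′} eq eq′ rewrite eq | eq′ = solve (b ∷ c ∷ c′ ∷ [])
  unimodular-cross minus {a} {b} {c} {d} {a′} {c′} eq eq′ rewrite eq | eq′ = solve (a ∷ a′ ∷ d ∷ [])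

  ∣∧<⇒≡0 : ∀ {m n} → m ∣ n → n < m → n ≡ 0
  ∣∧<⇒≡0 {n = zero}  _   _   = refl
  ∣∧<⇒≡0 {n = suc _} m∣n n<m = contradiction m∣n (>⇒∤ n<m)

  -- The hypothesis says r·d ≡ r′·d (mod b), and d is invertible modulo b.
  coprime-remainder-unique : ∀ {b d r r′ c c′} → Coprime b d → r′ < b →
    r * d + b * c′ ≡ r′ * d + b * c → r ≤ r′ → r ≡ r′
  coprime-remainder-unique {b} {d} {r} {r′} {c} {c′} cop r′<b eq r≤r′ = begin
    r     ≡⟨ +-identityʳ r ⟨
    r + 0 ≡⟨ cong (λ x → r + x) (∣∧<⇒≡0 b∣δ (≤-<-trans (m∸n≤m r′ r) r′<b)) ⟨
    r + δ ≡⟨ m+[n∸m]≡n r≤r′ ⟩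
    r′    ∎
    where
    open ≡-Reasoning
    δ : ℕ
    δ = r′ ∸ r
    bc′≡bc+δd : b * c′ ≡ b * c + δ * d
    bc′≡bc+δd = +-cancelˡ-≡ (r * d) _ _ (begin
      r * d + b * c′          ≡⟨ eq ⟩
      r′ * d + b * c          ≡⟨ cong (λ x → x * d + b * c) (m+[n∸m]≡n r≤r′) ⟨
      (r + δ) * d + b * c     ≡⟨ cong (_+ b * c) (*-distribʳ-+ d r δ) ⟩
      r * d + δ * d + b * c   ≡⟨ +-assoc (r * d) (δ * d) (b * c) ⟩
      r * d + (δ * d + b * c) ≡⟨ cong (λ x → r * d + x) (+-comm (δ * d) (b * c)) ⟩
      r * d + (b * c + δ * d) ∎)
    b∣δ : b ∣ δ
    b∣δ = coprime-divisor cop (subst (b ∣_) (*-comm δ d)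
            (∣m+n∣m⇒∣n (subst (b ∣_) bc′≡bc+δd (∣m⇒∣m*n c′ ∣-refl)) (∣m⇒∣m*n c ∣-refl)))

  unimodular-determined : ∀ t {a b c d a′ c′} .{{_ : NonZero b}} →
    Unimodular t a b c d → Unimodular t a′ b c′ d → a / b ≡ a′ / b → a ≡ a′ × c ≡ c′
  unimodular-determined t {a} {b} {c} {d} {a′} {c′} u u′ q≡q′ = a≡a′ , c≡c′
    where
    open ≡-Reasoning
    q r r′ : ℕ
    q = a / b
    r = a % b
    r′ = a′ % b
    a≡r+qb : a ≡ r + q * b
    a≡r+qb = m≡m%n+[m/n]*n a b
    a′≡r′+qb : a′ ≡ r′ + q * b
    a′≡r′+qb = trans (m≡m%n+[m/n]*n a′ b) (cong (λ x → r′ + x * b) (sym q≡q′))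
    rearrange : ∀ r q b d x → (r + q * b) * d + x ≡ r * d + x + q * b * d
    rearrange = solve-∀
    same-class : r * d + b * c′ ≡ r′ * d + b * c
    same-class = +-cancelʳ-≡ (q * b * d) _ _ (begin
      r * d + b * c′ + q * b * d ≡⟨ rearrange r q b d (b * c′) ⟨
      (r + q * b) * d + b * c′   ≡⟨ cong (λ x → x * d + b * c′) a≡r+qb ⟨
      a * d + b * c′             ≡⟨ unimodular-cross t u u′ ⟩
      a′ * d + b * c             ≡⟨ cong (λ x → x * d + b * c) a′≡r′+qb ⟩
      (r′ + q * b) * d + b * c   ≡⟨ rearrange r′ q b d (b * c) ⟩
      r′ * d + b * c + q * b * d ∎)
    r≡r′ : r ≡ r′
    r≡r′ with ≤-total r r′
    ... | inj₁ r≤r′ = coprime-remainder-unique (unimodular⇒coprime t u) (m%n<n a′ b) same-class r≤r′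
    ... | inj₂ r′≤r = sym (coprime-remainder-unique (unimodular⇒coprime t u) (m%n<n a b) (sym same-class) r′≤r)
    a≡a′ : a ≡ a′
    a≡a′ = trans a≡r+qb (trans (cong (_+ q * b) r≡r′) (sym a′≡r′+qb))
    c≡c′ : c ≡ c′
    c≡c′ = sym (*-cancelˡ-≡ c′ c b (+-cancelˡ-≡ (a * d) _ _
             (trans (unimodular-cross t u u′) (cong (λ x → x * d + b * c) (sym a≡a′)))))

  σ-determined-by-b : ∀ {e t a b c d a′ c′} .{{_ : NonZero b}} →
    Unimodular t a b c d → Unimodular t a′ b c′ d →
    a / b ≡ a′ / b → σ⟨ e , a , b , c , d ⟩ ≡ σ⟨ e , a′ , b , c′ , d ⟩
  σ-determined-by-b {t = t} u u′ q≡q′ with unimodular-determined t u u′ q≡q′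
  ... | refl , refl = refl

  σ-determined-by-c : ∀ {e t a b c d a′ b′} .{{_ : NonZero c}} →
    Unimodular t a b c d → Unimodular t a′ b′ c d →
    a / c ≡ a′ / c → σ⟨ e , a , b , c , d ⟩ ≡ σ⟨ e , a′ , b′ , c , d ⟩
  σ-determined-by-c {t = t} u u′ q≡q′
    with unimodular-determined t (unimodular-transpose t u) (unimodular-transpose t u′) q≡q′
  ... | refl , refl = refl

  unimodular⇒ad≤bc+1 : ∀ t {a b c d} → Unimodular t a b c d → a * d ≤ b * c + 1
  unimodular⇒ad≤bc+1 plus  ad≡bc+1 = ≤-reflexive ad≡bc+1
  unimodular⇒ad≤bc+1 minus {a} {b} {c} {d} bc≡ad+1 =
    ≤-trans (m≤m+n (a * d) 1) (≤-trans (≤-reflexive (sym bc≡ad+1)) (m≤m+n (b * c) 1))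

  unimodular⇒d≤2c : ∀ t {a b c d} → Unimodular t a b c d → 1 ≤ c → b < 2 * a → d ≤ 2 * c
  unimodular⇒d≤2c t {zero} _ _ ()
  unimodular⇒d≤2c t {a@(suc _)} {b} {c} {d} u 1≤c b<2a = *-cancelˡ-≤ a (begin
    a * d       ≤⟨ unimodular⇒ad≤bc+1 t u ⟩
    b * c + 1   ≤⟨ +-monoʳ-≤ (b * c) 1≤c ⟩
    b * c + c   ≡⟨ +-comm (b * c) c ⟩
    suc b * c   ≤⟨ *-monoˡ-≤ c b<2a ⟩
    2 * a * c   ≡⟨ reassoc a c ⟩
    a * (2 * c) ∎)
    where
    open ≤-Reasoning
    reassoc : ∀ a c → 2 * a * c ≡ a * (2 * c)
    reassoc = solve-∀

module Counting where
  open import Data.Nat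
  open import Data.Nat.Properties
  open import Data.Nat.DivMod using (_%_; m<n⇒m%n≡m; [m+kn]%n≡m%n)
  open import Data.Nat.Tactic.RingSolver using (solve-∀)
  open import Data.Fin using (Fin; zero; suc; fromℕ<; toℕ)
  open import Data.Fin.Properties using (injective⇒≤; toℕ-fromℕ<)
  open import Data.List using (List; []; _∷_; length; lookup)
  open import Data.List.Membership.Propositional.Properties using (∈-lookup)
  open import Data.List.Relation.Unary.All as All using (All; _∷_)
  open import Data.List.Relation.Unary.AllPairs using (_∷_)
  open import Data.List.Relation.Unary.Unique.Propositional using (Unique)
  open import Data.Product using (_×_; _,_; ∃-syntax; proj₁; proj₂)
  open import Data.Sum using (inj₁; inj₂)
  open import Relation.Binary.PropositionalEquality
  open import Relation.Nullary using (yes; no; contradiction)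

  lookup-injective : ∀ {A : Set} {xs : List A} → Unique xs → ∀ {i j} → lookup xs i ≡ lookup xs j → i ≡ j
  lookup-injective (_ ∷ _)      {zero}  {zero}  _  = refl
  lookup-injective (x∉xs ∷ _)   {zero}  {suc j} eq = contradiction eq (All.lookup x∉xs (∈-lookup j))
  lookup-injective (x∉xs ∷ _)   {suc i} {zero}  eq = contradiction (sym eq) (All.lookup x∉xs (∈-lookup i))
  lookup-injective (_ ∷ unique) {suc i} {suc j} eq = cong suc (lookup-injective unique eq)

  length-≤-injectiveCode : ∀ {A : Set} {S : A → Set} {M} (code : ∀ {x} → S x → ℕ) →
    (∀ {x} (s : S x) → code s < M) → (∀ {x y} (s : S x) (s′ : S y) → code s ≡ code s′ → x ≡ y) →
    ∀ {xs} → Unique xs → All S xs → length xs ≤ M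
  length-≤-injectiveCode {S = S} {M} code code-< code-injective {xs} unique sxs = injective⇒≤ f-injective
    where
    s : ∀ i → S (lookup xs i)
    s i = All.lookup sxs (∈-lookup {xs = xs} i)
    f : Fin (length xs) → Fin M
    f i = fromℕ< (code-< (s i))
    f-injective : ∀ {i j} → f i ≡ f j → i ≡ j
    f-injective {i} {j} eq = lookup-injective unique (code-injective (s i) (s j)
      (trans (sym (toℕ-fromℕ< (code-< (s i)))) (trans (cong toℕ eq) (toℕ-fromℕ< (code-< (s j))))))

  radix-injective : ∀ {R u v u′ v′} .{{_ : NonZero R}} → u < R → u′ < R →
    u + v * R ≡ u′ + v′ * R → u ≡ u′ × v ≡ v′
  radix-injective {R} {u} {v} {u′} {v′} u<R u′<R eq = u≡u′ , *-cancelʳ-≡ v v′ R (+-cancelˡ-≡ u _ _ eq′)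
    where
    open ≡-Reasoning
    u≡u′ : u ≡ u′
    u≡u′ = begin
      u                 ≡⟨ m<n⇒m%n≡m u<R ⟨
      u % R             ≡⟨ [m+kn]%n≡m%n u v R ⟨
      (u + v * R) % R   ≡⟨ cong (_% R) eq ⟩
      (u′ + v′ * R) % R ≡⟨ [m+kn]%n≡m%n u′ v′ R ⟩
      u′ % R            ≡⟨ m<n⇒m%n≡m u′<R ⟩
      u′                ∎
    eq′ : u + v * R ≡ u + v′ * R
    eq′ = trans eq (cong (_+ v′ * R) (sym u≡u′))

  radix-< : ∀ {R S u v} → u < R → v < S → u + v * R < S * R
  radix-< {R} {S} {u} {v} u<R v<S = <-≤-trans (+-monoˡ-< (v * R) u<R) (*-monoˡ-≤ R v<S)

  isqrt : ∀ n → ∃[ r ] r * r ≤ n × n < suc r * suc r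
  isqrt zero = 0 , z≤n , s≤s z≤n
  isqrt (suc n) with isqrt n
  ... | r , r²≤n , n<[1+r]² with m≤n⇒m<n∨m≡n n<[1+r]²
  ...   | inj₁ 1+n<[1+r]² = r , m≤n⇒m≤1+n r²≤n , 1+n<[1+r]²
  ...   | inj₂ 1+n≡[1+r]² = suc r , ≤-reflexive (sym 1+n≡[1+r]²) ,
            subst (_< suc (suc r) * suc (suc r)) (sym 1+n≡[1+r]²) (*-mono-< (n<1+n (suc r)) (n<1+n (suc r)))

  ≤-isqrt : ∀ {n r x} → n < suc r * suc r → x * x ≤ n → x ≤ r
  ≤-isqrt {n} {r} {x} n<[1+r]² x²≤n with x ≤? r
  ... | yes x≤r = x≤r
  ... | no x≰r = contradiction (≤-trans (*-mono-≤ (≰⇒> x≰r) (≰⇒> x≰r)) x²≤n) (<⇒≱ n<[1+r]²)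

  record Key : Set where
    constructor key
    field tag x y z : ℕ

  Admissible : ℕ → ℕ → ℕ → Key → Set
  Admissible γ β N (key t x y z) = t < 8 × 1 ≤ x × x * x ≤ γ * N × y ≤ 2 * x × x * z ≤ β * N

  -- Mixed radix: the base 2x + 1 of y ≤ 2x varies with x, which keeps y + z(2x + 1) ≪ N.
  pack : ℕ → Key → ℕ
  pack X (key t x y z) = t + (x + (y + z * suc (2 * x)) * suc X) * 8

  pack-injective : ∀ {γ β N X} k k′ → Admissible γ β N k → Admissible γ β N k′ →
    Key.x k ≤ X → Key.x k′ ≤ X → pack X k ≡ pack X k′ → k ≡ k′
  pack-injective {X = X} (key t x y z) (key t′ x′ y′ z′)
                 (t<8 , _ , _ , y≤2x , _) (t′<8 , _ , _ , y′≤2x′ , _) x≤X x′≤X eq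
    with radix-injective {v = x + (y + z * suc (2 * x)) * suc X} {v′ = x′ + (y′ + z′ * suc (2 * x′)) * suc X}
                         t<8 t′<8 eq
  ... | refl , eq₁ with radix-injective {v = y + z * suc (2 * x)} {v′ = y′ + z′ * suc (2 * x′)}
                                        (s≤s x≤X) (s≤s x′≤X) eq₁
  ... | refl , eq₂ with radix-injective {v = z} {v′ = z′} (s≤s y≤2x) (s≤s y′≤2x′) eq₂
  ... | refl , refl = refl

  packed-pair-≤ : ∀ {γ β N} k → Admissible γ β N k →
    Key.y k + Key.z k * suc (2 * Key.x k) ≤ (2 * γ + 3 * β) * N
  packed-pair-≤ {γ} {β} {N} (key t x y z) (_ , 1≤x , x²≤γN , y≤2x , xz≤βN) = begin
    y + z * suc (2 * x)       ≤⟨ +-mono-≤ (≤-trans y≤2x (*-monoʳ-≤ 2 x≤x²)) (*-monoʳ-≤ z (+-monoˡ-≤ (2 * x) 1≤x)) ⟩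
    2 * (x * x) + z * (3 * x) ≡⟨ cong (2 * (x * x) +_) (z[3x]≡3[xz] x z) ⟩
    2 * (x * x) + 3 * (x * z) ≤⟨ +-mono-≤ (*-monoʳ-≤ 2 x²≤γN) (*-monoʳ-≤ 3 xz≤βN) ⟩
    2 * (γ * N) + 3 * (β * N) ≡⟨ distrib γ β N ⟩
    (2 * γ + 3 * β) * N       ∎
    where
    open ≤-Reasoning
    z[3x]≡3[xz] : ∀ x z → z * (3 * x) ≡ 3 * (x * z)
    z[3x]≡3[xz] = solve-∀
    distrib : ∀ γ β N → 2 * (γ * N) + 3 * (β * N) ≡ (2 * γ + 3 * β) * N
    distrib = solve-∀
    x≤x² : x ≤ x * x
    x≤x² = subst (_≤ x * x) (*-identityʳ x) (*-monoʳ-≤ x 1≤x)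

  pack-< : ∀ {γ β N X} k → Admissible γ β N k → Key.x k ≤ X →
    pack X k < suc ((2 * γ + 3 * β) * N) * suc X * 8
  pack-< {γ} {β} {N} k adm@(t<8 , _) x≤X =
    radix-< t<8 (radix-< (s≤s x≤X) (s≤s (packed-pair-≤ {γ} {β} {N} k adm)))

  2*≤square+1 : ∀ n → 2 * n ≤ n * n + 1
  2*≤square+1 zero    = z≤n
  2*≤square+1 (suc k) = subst (2 * suc k ≤_) (expand k) (m≤n+m (2 * suc k) (k * k))
    where
    expand : ∀ k → k * k + 2 * suc k ≡ suc k * suc k + 1
    expand = solve-∀

  suc-square-≤ : ∀ {γ N X} → 1 ≤ N → X * X ≤ γ * N → suc X * suc X ≤ 2 * suc γ * N
  suc-square-≤ {γ} {N} {X} 1≤N X²≤γN = begin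
    suc X * suc X           ≡⟨ expand X ⟩
    X * X + (2 * X + 1)     ≤⟨ +-monoʳ-≤ (X * X) (+-monoˡ-≤ 1 (2*≤square+1 X)) ⟩
    X * X + (X * X + 1 + 1) ≡⟨ regroup (X * X) ⟩
    2 * (X * X) + 2 * 1     ≤⟨ +-mono-≤ (*-monoʳ-≤ 2 X²≤γN) (*-monoʳ-≤ 2 1≤N) ⟩
    2 * (γ * N) + 2 * N     ≡⟨ collect γ N ⟩
    2 * suc γ * N           ∎
    where
    open ≤-Reasoning
    expand : ∀ X → suc X * suc X ≡ X * X + (2 * X + 1)
    expand = solve-∀
    regroup : ∀ s → s + (s + 1 + 1) ≡ 2 * s + 2 * 1
    regroup = solve-∀
    collect : ∀ γ N → 2 * (γ * N) + 2 * N ≡ 2 * suc γ * N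
    collect = solve-∀

  keyConstant : ℕ → ℕ → ℕ
  keyConstant γ β = suc (2 * γ + 3 * β) * (2 * suc γ) * 8

  pack-range²-≤ : ∀ {γ β N X} → 1 ≤ N → X * X ≤ γ * N →
    (suc ((2 * γ + 3 * β) * N) * suc X * 8) ^ 2 ≤ keyConstant γ β ^ 2 * N ^ 3
  pack-range²-≤ {γ} {β} {N} {X} 1≤N X²≤γN = begin
    (suc W * suc X * 8) ^ 2
      ≡⟨ square-product (suc W) (suc X) ⟩
    suc W * suc W * (suc X * suc X) * 64
      ≤⟨ *-monoˡ-≤ 64 (*-mono-≤ (*-mono-≤ 1+W≤ 1+W≤) (suc-square-≤ {γ} {N} {X} 1≤N X²≤γN)) ⟩
    suc K * N * (suc K * N) * (H * N) * 64
      ≤⟨ *-monoˡ-≤ 64 (*-monoʳ-≤ (suc K * N * (suc K * N)) (*-monoˡ-≤ N (m≤m*n H H))) ⟩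
    suc K * N * (suc K * N) * (H * H * N) * 64
      ≡⟨ collect (suc K) H N ⟩
    (suc K * H * 8) ^ 2 * N ^ 3 ∎
    where
    open ≤-Reasoning
    K W H : ℕ
    K = 2 * γ + 3 * β
    W = K * N
    H = 2 * suc γ
    1+W≤ : suc W ≤ suc K * N
    1+W≤ = +-monoˡ-≤ W 1≤N
    square-product : ∀ u v → u * v * 8 * (u * v * 8 * 1) ≡ u * u * (v * v) * 64
    square-product = solve-∀
    collect : ∀ k g n → k * n * (k * n) * (g * g * n) * 64 ≡ k * g * 8 * (k * g * 8 * 1) * (n * (n * (n * 1)))
    collect = solve-∀

  ^-distribʳ-* : ∀ m n k → (m * n) ^ k ≡ m ^ k * n ^ k
  ^-distribʳ-* m n zero    = refl
  ^-distribʳ-* m n (suc k) = trans (cong (m * n *_) (^-distribʳ-* m n k)) (interchange m n (m ^ k) (n ^ k))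
    where
    interchange : ∀ a b c d → a * b * (c * d) ≡ a * c * (b * d)
    interchange = solve-∀

  ^-monoʳ-≤-pos : ∀ n {i j} → 1 ≤ i → i ≤ j → n ^ i ≤ n ^ j
  ^-monoʳ-≤-pos zero    {suc _} _ _   = z≤n
  ^-monoʳ-≤-pos (suc n) _       i≤j = ^-monoʳ-≤ (suc n) i≤j

  square⇒cardBound : ∀ {L C N} p q → 1 ≤ q → L ^ 2 ≤ C ^ 2 * N ^ 3 →
    L ^ (2 * q) ≤ C ^ (2 * q) * N ^ (3 * q + 2 * p)
  square⇒cardBound {L} {C} {N} p q 1≤q L²≤ = begin
    L ^ (2 * q)                       ≡⟨ ^-*-assoc L 2 q ⟨
    (L ^ 2) ^ q                       ≤⟨ ^-monoˡ-≤ q L²≤ ⟩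
    (C ^ 2 * N ^ 3) ^ q               ≡⟨ ^-distribʳ-* (C ^ 2) (N ^ 3) q ⟩
    (C ^ 2) ^ q * (N ^ 3) ^ q         ≡⟨ cong₂ _*_ (^-*-assoc C 2 q) (^-*-assoc N 3 q) ⟩
    C ^ (2 * q) * N ^ (3 * q)         ≤⟨ *-monoʳ-≤ (C ^ (2 * q)) (^-monoʳ-≤-pos N 1≤3q (m≤m+n (3 * q) (2 * p))) ⟩
    C ^ (2 * q) * N ^ (3 * q + 2 * p) ∎
    where
    open ≤-Reasoning
    1≤3q : 1 ≤ 3 * q
    1≤3q = ≤-trans 1≤q (m≤n*m q 3)

  keys-length²-≤ : ∀ {S : Mat2 → Set} γ β N (k : ∀ {σ} → S σ → Key) →
    (∀ {σ} (s : S σ) → Admissible γ β N (k s)) → (∀ {σ τ} (s : S σ) (s′ : S τ) → k s ≡ k s′ → σ ≡ τ) →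
    ∀ {xs} → Unique xs → All S xs → length xs ^ 2 ≤ keyConstant γ β ^ 2 * N ^ 3
  keys-length²-≤ γ β zero k adm _ {[]} _ _ = z≤n
  keys-length²-≤ γ β zero k adm _ {_ ∷ _} _ (s ∷ _) with adm s
  ... | _ , 1≤x , x²≤γ*0 , _ =
    contradiction (≤-trans (*-mono-≤ 1≤x 1≤x) (≤-trans x²≤γ*0 (≤-reflexive (*-zeroʳ γ)))) λ ()
  keys-length²-≤ {S} γ β N@(suc _) k adm k-injective {xs} unique sxs =
    ≤-trans (^-monoˡ-≤ 2 length≤) (pack-range²-≤ {γ} {β} {N} {X} (s≤s z≤n) X²≤γN)
    where
    X : ℕ
    X = proj₁ (isqrt (γ * N))
    X²≤γN : X * X ≤ γ * N
    X²≤γN = proj₁ (proj₂ (isqrt (γ * N)))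
    x≤X : ∀ {σ} (s : S σ) → Key.x (k s) ≤ X
    x≤X s with adm s
    ... | _ , _ , x²≤γN , _ = ≤-isqrt (proj₂ (proj₂ (isqrt (γ * N)))) x²≤γN
    code : ∀ {σ} → S σ → ℕ
    code s = pack X (k s)
    length≤ : length xs ≤ suc ((2 * γ + 3 * β) * N) * suc X * 8
    length≤ = length-≤-injectiveCode code (λ s → pack-< {γ} {β} {N} {X} (k s) (adm s) (x≤X s))
      (λ s s′ eq → k-injective s s′
         (pack-injective {γ} {β} {N} {X} (k s) (k s′) (adm s) (adm s′) (x≤X s) (x≤X s′) eq))
      unique sxs

  keys-cardBound : ∀ {S : Mat2 → Set} γ β N p q → 1 ≤ q → (k : ∀ {σ} → S σ → Key) →
    (∀ {σ} (s : S σ) → Admissible γ β N (k s)) → (∀ {σ τ} (s : S σ) (s′ : S τ) → k s ≡ k s′ → σ ≡ τ) →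
    CardBound S (keyConstant γ β) N p q
  keys-cardBound γ β N p q 1≤q k adm k-injective xs unique sxs =
    square⇒cardBound p q 1≤q (keys-length²-≤ γ β N k adm k-injective unique sxs)

module Keys where
  open Embedding using (≤-∣↥∣-*)
  open EntryBounds using (ratio⇒b<2a; b²≤3N)
  open Unimodular
  open Counting
  open import Data.Nat
  open import Data.Nat.Properties
  open import Data.Nat.DivMod using (_/_; m/n*n≤m; m≥n⇒m/n>0)
  open import Data.Nat.Tactic.RingSolver using (solve-∀)
  open import Data.Integer as ℤ using ()
  open import Data.Rational using (ℚ; ↥_)
  open import Data.Product using (_×_; _,_; ∃; proj₁; proj₂)
  open import Relation.Binary.PropositionalEquality
  open import Relation.Nullary using (Dec; yes; no; contradiction)

  bit : Sign → ℕ
  bit plus  = 0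
  bit minus = 1

  bit<2 : ∀ s → bit s < 2
  bit<2 plus  = s≤s z≤n
  bit<2 minus = s≤s (s≤s z≤n)

  bit-injective : ∀ {s s′} → bit s ≡ bit s′ → s ≡ s′
  bit-injective {plus}  {plus}  _ = refl
  bit-injective {minus} {minus} _ = refl

  signTag : Sign → Sign → ℕ
  signTag e t = bit t + bit e * 2

  signTag<4 : ∀ e t → signTag e t < 4
  signTag<4 e t = radix-< (bit<2 t) (bit<2 e)

  signTag-injective : ∀ {e t e′ t′} → signTag e t ≡ signTag e′ t′ → e ≡ e′ × t ≡ t′
  signTag-injective {e} {t} {e′} {t′} eq with radix-injective {v = bit e} {v′ = bit e′} (bit<2 t) (bit<2 t′) eq
  ... | t≡t′ , e≡e′ = bit-injective e≡e′ , bit-injective t≡t′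

  signTag≢signTag+4 : ∀ e t e′ t′ → signTag e t ≢ signTag e′ t′ + 4
  signTag≢signTag+4 e t e′ t′ eq = <-irrefl eq (<-≤-trans (signTag<4 e t) (m≤n+m 4 (signTag e′ t′)))

  m*[n/m]≤n : ∀ m n .{{_ : NonZero m}} → m * (n / m) ≤ n
  m*[n/m]≤n m n = subst (_≤ n) (*-comm (n / m) m) (m/n*n≤m n m)

  square-≤-of-large : ∀ {c x k N} → 1 ≤ c → N ≤ c * c → x * c ≤ k * N → x * x ≤ k * k * N
  square-≤-of-large {c@(suc _)} {x} {k} {N} _ N≤c² xc≤kN = *-cancelˡ-≤ (c * c) (begin
    c * c * (x * x)     ≡⟨ regroup c x ⟩
    x * c * (x * c)     ≤⟨ *-mono-≤ xc≤kN xc≤kN ⟩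
    k * N * (k * N)     ≡⟨ regroup′ k N ⟩
    N * (k * k * N)     ≤⟨ *-monoˡ-≤ (k * k * N) N≤c² ⟩
    c * c * (k * k * N) ∎)
    where
    open ≤-Reasoning
    regroup : ∀ c x → c * c * (x * x) ≡ x * c * (x * c)
    regroup = solve-∀
    regroup′ : ∀ k N → k * N * (k * N) ≡ N * (k * k * N)
    regroup′ = solve-∀

  module A₁ (K : ℚ) (N : ℕ) where

    K′ : ℕ
    K′ = ℤ.∣ ↥ K ∣

    keyOf : Sign → Sign → (a b d : ℕ) .{{_ : NonZero b}} → Key
    keyOf e t a b d = key (signTag e t) b d (a / b)

    keyOf-injective : ∀ {e t a b c d e′ t′ a′ b′ c′ d′} .{{_ : NonZero b}} .{{_ : NonZero b′}} →
      Unimodular t a b c d → Unimodular t′ a′ b′ c′ d′ →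
      keyOf e t a b d ≡ keyOf e′ t′ a′ b′ d′ → σ⟨ e , a , b , c , d ⟩ ≡ σ⟨ e′ , a′ , b′ , c′ , d′ ⟩
    keyOf-injective {e} {t} {e′ = e′} {t′} {{b≢0}} u u′ eq
      with signTag-injective {e} {t} {e′} {t′} (cong Key.tag eq) | cong Key.x eq | cong Key.y eq
    ... | refl , refl | refl | refl = σ-determined-by-b {e} {{b≢0}} u u′ (cong Key.z eq)

    key₁ : ∀ {σ} → InA₁ K N σ → Key
    key₁ (e , a , b , c , d , _ , ((gl , _) , d≤b , _) , _) =
      keyOf e (proj₁ u) a b d {{unimodular-nonZero _ (proj₂ u) d≤b}}
      where
      u : ∃ λ t → Unimodular t a b c d
      u = unimodular e a b c d gl

    key₁-admissible : ∀ {σ} (s : InA₁ K N σ) → Admissible 3 K′ N (key₁ s)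
    key₁-admissible (e , a , b , c , d , _ , ((gl , _) , d≤b , _) , cond , a≤KN) =
      ≤-trans (signTag<4 e (proj₁ u)) (m≤m+n 4 4) , >-nonZero⁻¹ b , b²≤3N N b d d≤b cond ,
      ≤-trans d≤b (m≤m+n b (b + 0)) , ≤-trans (m*[n/m]≤n b a) (≤-∣↥∣-* K N a≤KN)
      where
      u : ∃ λ t → Unimodular t a b c d
      u = unimodular e a b c d gl
      instance
        b≢0 : NonZero b
        b≢0 = unimodular-nonZero _ (proj₂ u) d≤b

    key₁-injective : ∀ {σ τ} (s : InA₁ K N σ) (s′ : InA₁ K N τ) → key₁ s ≡ key₁ s′ → σ ≡ τ
    key₁-injective (e , a , b , c , d , refl , ((gl , _) , d≤b , _) , _)
                   (e′ , a′ , b′ , c′ , d′ , refl , ((gl′ , _) , d′≤b′ , _) , _) =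
      keyOf-injective {e} {e′ = e′} {{unimodular-nonZero _ u d≤b}} {{unimodular-nonZero _ u′ d′≤b′}} u u′
      where
      u : Unimodular (proj₁ (unimodular e a b c d gl)) a b c d
      u = proj₂ (unimodular e a b c d gl)
      u′ : Unimodular (proj₁ (unimodular e′ a′ b′ c′ d′ gl′)) a′ b′ c′ d′
      u′ = proj₂ (unimodular e′ a′ b′ c′ d′ gl′)

  module A₂ (K : ℚ) (N : ℕ) where

    K′ : ℕ
    K′ = ℤ.∣ ↥ K ∣

    keyOf : Sign → Sign → (a c d : ℕ) .{{_ : NonZero c}} → Dec (c * c ≤ N) → Key
    keyOf e t a c d (yes _) = key (signTag e t) c d (a / c)
    keyOf e t a c d (no _)  = key (signTag e t + 4) (d + a / c) d c

    keyOf-admissible : ∀ {e t a b c d} .{{_ : NonZero c}} → Unimodular t a b c d →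
      1 ≤ c → c ≤ a → b < 2 * a → c * d ≤ N → a ≤ K′ * N →
      (dec : Dec (c * c ≤ N)) → Admissible (suc K′ * suc K′) (suc K′) N (keyOf e t a c d dec)
    keyOf-admissible {e} {t} {a} {b} {c} {d} u 1≤c c≤a b<2a cd≤N a≤K′N (yes c²≤N) =
      ≤-trans (signTag<4 e t) (m≤m+n 4 4) , 1≤c , ≤-trans c²≤N (m≤n*m N (suc K′ * suc K′)) ,
      unimodular⇒d≤2c t u 1≤c b<2a , ≤-trans (m*[n/m]≤n c a) (≤-trans a≤K′N (m≤n+m (K′ * N) N))
    keyOf-admissible {e} {t} {a} {b} {c} {d} u 1≤c c≤a b<2a cd≤N a≤K′N (no c²≰N) =
      +-monoˡ-< 4 (signTag<4 e t) , ≤-trans (m≥n⇒m/n>0 c≤a) (m≤n+m (a / c) d) ,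
      square-≤-of-large {x = d + a / c} {suc K′} 1≤c (<⇒≤ (≰⇒> c²≰N)) xc≤[1+K′]N ,
      ≤-trans (m≤m+n d (a / c)) (m≤m+n (d + a / c) (d + a / c + 0)) , xc≤[1+K′]N
      where
      xc≤[1+K′]N : (d + a / c) * c ≤ suc K′ * N
      xc≤[1+K′]N = begin
        (d + a / c) * c   ≡⟨ *-distribʳ-+ c d (a / c) ⟩
        d * c + a / c * c ≤⟨ +-mono-≤ (subst (_≤ N) (*-comm c d) cd≤N) (≤-trans (m/n*n≤m a c) a≤K′N) ⟩
        N + K′ * N        ∎
        where open ≤-Reasoning

    keyOf-injective : ∀ {e t a b c d e′ t′ a′ b′ c′ d′} .{{_ : NonZero c}} .{{_ : NonZero c′}} →
      Unimodular t a b c d → Unimodular t′ a′ b′ c′ d′ → (dec : Dec (c * c ≤ N)) (dec′ : Dec (c′ * c′ ≤ N)) →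
      keyOf e t a c d dec ≡ keyOf e′ t′ a′ c′ d′ dec′ → σ⟨ e , a , b , c , d ⟩ ≡ σ⟨ e′ , a′ , b′ , c′ , d′ ⟩
    keyOf-injective {e} {t} {e′ = e′} {t′} {{c≢0}} u u′ (yes _) (yes _) eq
      with signTag-injective {e} {t} {e′} {t′} (cong Key.tag eq) | cong Key.x eq | cong Key.y eq
    ... | refl , refl | refl | refl = σ-determined-by-c {e} {{c≢0}} u u′ (cong Key.z eq)
    keyOf-injective {e} {t} {d = d} {e′ = e′} {t′} {{c≢0}} u u′ (no _) (no _) eq
      with signTag-injective {e} {t} {e′} {t′} (+-cancelʳ-≡ 4 _ _ (cong Key.tag eq))
         | cong Key.z eq | cong Key.y eq
    ... | refl , refl | refl | refl = σ-determined-by-c {e} {{c≢0}} u u′ (+-cancelˡ-≡ d _ _ (cong Key.x eq))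
    keyOf-injective {e} {t} {e′ = e′} {t′} _ _ (yes _) (no _) eq =
      contradiction (cong Key.tag eq) (signTag≢signTag+4 e t e′ t′)
    keyOf-injective {e} {t} {e′ = e′} {t′} _ _ (no _) (yes _) eq =
      contradiction (sym (cong Key.tag eq)) (signTag≢signTag+4 e′ t′ e t)

    key₂ : ∀ {σ} → InA₂ K N σ → Key
    key₂ (e , a , b , c , d , _ , ((gl , _) , _ , 1≤c , _) , _) =
      keyOf e (proj₁ (unimodular e a b c d gl)) a c d {{>-nonZero 1≤c}} (c * c ≤? N)

    key₂-admissible : ∀ {σ} (s : InA₂ K N σ) → Admissible (suc K′ * suc K′) (suc K′) N (key₂ s)
    key₂-admissible (e , a , b , c , d , _ , ((gl , _) , _ , 1≤c , c≤a , ratio) , cd≤N , a≤KN) =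
      keyOf-admissible {e} {{>-nonZero 1≤c}} (proj₂ (unimodular e a b c d gl)) 1≤c c≤a (ratio⇒b<2a e a b ratio)
        cd≤N (≤-∣↥∣-* K N a≤KN) (c * c ≤? N)

    key₂-injective : ∀ {σ τ} (s : InA₂ K N σ) (s′ : InA₂ K N τ) → key₂ s ≡ key₂ s′ → σ ≡ τ
    key₂-injective (e , a , b , c , d , refl , ((gl , _) , _ , 1≤c , _) , _)
                   (e′ , a′ , b′ , c′ , d′ , refl , ((gl′ , _) , _ , 1≤c′ , _) , _) =
      keyOf-injective {e} {e′ = e′} {{>-nonZero 1≤c}} {{>-nonZero 1≤c′}}
        (proj₂ (unimodular e a b c d gl)) (proj₂ (unimodular e′ a′ b′ c′ d′ gl′)) (c * c ≤? N) (c′ * c′ ≤? N)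

open import Data.Nat using (ℕ; suc; _*_; _≤_)
open import Data.Integer as ℤ using ()
open import Data.Rational using (ℚ; 0ℚ; _<_; ↥_)
open import Data.Product using (∃-syntax; _,_)
open Counting using (keyConstant; keys-cardBound)
open Keys using (module A₁; module A₂)

-- The bound holds with ε = 0 (|A| ≪ N^{3/2}).
lemma18 : (K : ℚ) → 0ℚ < K → (r : Idx) → (p q : ℕ) → 1 ≤ p → 1 ≤ q →
    ∃[ C ] ((N : ℕ) → CardBound (A[ r ] K N) C N p q)
lemma18 K _ r1 p q _ 1≤q = keyConstant 3 K′ , λ N →
  keys-cardBound 3 K′ N p q 1≤q
    (A₁.key₁ K N) (A₁.key₁-admissible K N) (A₁.key₁-injective K N)
  where
  K′ : ℕ
  K′ = ℤ.∣ ↥ K ∣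
lemma18 K _ r2 p q _ 1≤q = keyConstant (suc K′ * suc K′) (suc K′) , λ N →
  keys-cardBound (suc K′ * suc K′) (suc K′) N p q 1≤q
    (A₂.key₂ K N) (A₂.key₂-admissible K N) (A₂.key₂-injective K N)
  where
  K′ : ℕ
  K′ = ℤ.∣ ↥ K ∣
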